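{- Let $F\colon (L+\{\tau\})\to[S\to\mathcal P S]$ and $G\colon (L+\{\tau\})\to[T\to\mathcal P T]$ be labelled transition systems with internal action, and $R\subseteq S\times T$. The following are equivalent: (1) $R$ is a weak bisimulation between $F$ and $G$; (2) $(\overline F,\overline G)\in \mathrm{Id}_{L+\{\tau\}}\to[R\to\mathcal P R]$, i.e. for every $a\in L+\{\tau\}$ and all $s\in S,t\in T$ with $sRt$, $\overline F(a)(s)\,[\mathcal P R]\,\overline G(a)(t)$; (3) $R$ is the state space of a saturated transition system in the category $\mathsf{Rel}$ whose first projection is $\overline F$ and whose second projection is $\overline G$, i.e. for every $a\in L+\{\tau\}$ the pair $(\overline F(a),\overline G(a))$ is a morphism $(R,S,T)\to(\mathcal P R,\mathcal P S,\mathcal P T)$ in $\mathsf{Rel}$, and both $\overline F$ and $\overline G$ are saturated.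
   Context: $L$ is a set of labels not containing $\tau$. A labelled transition system with internal action on $S$ is a function $F\colon (L+\{\tau\})\to[S\to\mathcal P S]$; write $s\xrightarrow{a}s'$ for $s'\in F(a)(s)$, extended to words by composition. For a word $w$ over $L+\{\tau\}$, $\hat w$ deletes all $\tau$'s; for $a\in L+\{\tau\}$, $\hat a$ is $a$ if $a\in L$ and the empty word if $a=\tau$; $s\overset{v}{\Rightarrow}s'$ iff $s\xrightarrow{w}s'$ for some $w$ with $\hat w=v$. $R\subseteq S\times T$ is a weak bisimulation iff for all $a$, whenever $sRt$: each $s\xrightarrow{a}s'$ has some $t'$ with $t\overset{\hat a}{\Rightarrow}t'$ and $s'Rt'$, and each $t\xrightarrow{a}t'$ has some $s'$ with $s\overset{\hat a}{\Rightarrow}s'$ and $s'Rt'$. For $R\subseteq S\times T$, $U\,[\mathcal P R]\,V$ (for $U\subseteq S$, $V\subseteq T$) iff every $u\in U$ is $R$-related to some $v\in V$ and every $v\in V$ is $R$-related to some $u\in U$. The saturation $\overline F$: $s'\in \overline F(\tau)(s)$ iff $s\xrightarrow{\tau^n}s'$ for some $n\ge0$; for $a\in L$, $s'\in\overline F(a)(s)$ iff $s\xrightarrow{\tau^m a \tau^n}s'$ for some $m,n\ge0$. For $f,g\colon S\to\mathcal P S$, $f\cdot g=\lambda s.\bigcup_{s'\in f(s)}g(s')$, $\mathrm{id}=\lambda s.\{s\}$, and $f\le g$ iff $f(s)\subseteq g(s)$ for all $s$. A system $F$ is saturated if $\mathrm{id}\le F(\tau)$, $F(\tau)\cdot F(\tau)\le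 F(\tau)$ and $F(\tau)\cdot F(a)\cdot F(\tau)\le F(a)$ for all $a\in L$. $\mathsf{Rel}$ is the category whose objects are triples $(R,A_1,A_2)$ with $R\subseteq A_1\times A_2$ and whose morphisms $(R,A_1,A_2)\to(R',B_1,B_2)$ are pairs of functions $f_i\colon A_i\to B_i$ with $(a_1,a_2)\in R\Rightarrow (f_1a_1,f_2a_2)\in R'$; $(\mathcal P R,\mathcal P S,\mathcal P T)$ denotes the relation $[\mathcal P R]$ between $\mathcal P S$ and $\mathcal P T$. -}

module Defs where

open import Level using (Level; _⊔_; Lift; 0ℓ) renaming (suc to lsuc)

open import Data.List using (List; []; _∷_)
open import Data.Sum using (_⊎_; inj₁; inj₂)
open import Data.Unit using (⊤; tt)
open import Data.Nat using (ℕ; zero; suc)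
open import Data.Product using (Σ; _×_; _,_; ∃)
open import Relation.Binary.PropositionalEquality using (_≡_)

-- L + {τ}: inj₁ a is a visible label, inj₂ tt is τ.
Lτ : Set → Set
Lτ L = L ⊎ ⊤

τ : {L : Set} → Lτ L
τ = inj₂ tt

𝒫 : Set → Set₁
𝒫 S = S → Set

Arr : Set → Set₁
Arr S = S → 𝒫 S

-- A labelled transition system with internal action on S:
-- F a s s'  means  s' ∈ F(a)(s).
LTS : Set → Set → Set₁
LTS L S = Lτ L → Arr S

_·_ : {S : Set} → Arr S → Arr S → Arr S
(f · g) s s'' = Σ _ λ s' → f s s' × g s' s''

idA : {S : Set} → Arr S
idA s s' = s ≡ s'

_≤A_ : {S : Set} → Arr S → Arr S → Set
f ≤A g = ∀ s s' → f s s' → g s s'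

Steps : {L S : Set} → LTS L S → List (Lτ L) → Arr S
Steps F []      s s' = s ≡ s'
Steps F (a ∷ w) s s' = (F a · Steps F w) s s'

hatW : {L : Set} → List (Lτ L) → List L
hatW []            = []
hatW (inj₁ a ∷ w)  = a ∷ hatW w
hatW (inj₂ _ ∷ w)  = hatW w

hatA : {L : Set} → Lτ L → List L
hatA (inj₁ a) = a ∷ []
hatA (inj₂ _) = []

WeakStep : {L S : Set} → LTS L S → List L → Arr S
WeakStep F v s s' = Σ (List (Lτ _)) λ w → hatW w ≡ v × Steps F w s s'

replicateτ : {L : Set} → ℕ → List (Lτ L)
replicateτ zero    = []
replicateτ (suc n) = τ ∷ replicateτ n

_++_ : {A : Set} → List A → List A → List A
[] ++ ys = ys
(x ∷ xs) ++ ys = x ∷ (xs ++ ys)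

saturate : {L S : Set} → LTS L S → LTS L S
saturate F (inj₂ _) s s' = Σ ℕ λ n → Steps F (replicateτ n) s s'
saturate F (inj₁ a) s s' =
  Σ ℕ λ m → Σ ℕ λ n → Steps F (replicateτ m ++ (inj₁ a ∷ replicateτ n)) s s'

IsWeakBisimulation : {L S T : Set} → LTS L S → LTS L T → (S → T → Set) → Set
IsWeakBisimulation {L} {S} {T} F G R =
  ∀ (a : Lτ L) (s : S) (t : T) → R s t →
    (∀ s' → F a s s' → Σ T λ t' → WeakStep G (hatA a) t t' × R s' t')
  × (∀ t' → G a t t' → Σ S λ s' → WeakStep F (hatA a) s s' × R s' t')

𝒫Rel : {S T : Set} → (S → T → Set) → 𝒫 S → 𝒫 T → Set
𝒫Rel {S} {T} R U V =
  (∀ u → U u → Σ T λ v → V v × R u v)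
  × (∀ v → V v → Σ S λ u → U u × R u v)

IsSaturated : {L S : Set} → LTS L S → Set
IsSaturated {L} F =
  (idA ≤A F τ) × ((F τ · F τ) ≤A F τ)
  × (∀ (a : L) → ((F τ · F (inj₁ a)) · F τ) ≤A F (inj₁ a))

record RelObj (ℓ : Level) : Set (lsuc ℓ) where
  constructor relObj
  field
    A₁  : Set ℓ
    A₂  : Set ℓ
    rel : A₁ → A₂ → Set ℓ

IsRelMorphism : {ℓ ℓ' : Level} (X : RelObj ℓ) (Y : RelObj ℓ') →
  (RelObj.A₁ X → RelObj.A₁ Y) → (RelObj.A₂ X → RelObj.A₂ Y) → Set (ℓ ⊔ ℓ')
IsRelMorphism X Y f₁ f₂ =
  ∀ a₁ a₂ → RelObj.rel X a₁ a₂ → RelObj.rel Y (f₁ a₁) (f₂ a₂)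

objR : {S T : Set} → (S → T → Set) → RelObj 0ℓ
objR {S} {T} R = relObj S T R

obj𝒫R : {S T : Set} → (S → T → Set) → RelObj (lsuc 0ℓ)
obj𝒫R {S} {T} R = relObj (𝒫 S) (𝒫 T) (λ U V → Lift (lsuc 0ℓ) (𝒫Rel R U V))

-- F̄(a)(s) is exactly the set of states reachable from s by a weak â-step, and weak steps
-- compose along concatenation of visible words. Hence F̄ is saturated, and the transfer
-- property of a weak bisimulation, applied along each transition of a path, lifts from
-- single transitions to saturated ones; conversely every transition is a saturated one.
module Submission where

open import Defs
open import Data.List using (List; []; _∷_)
open import Data.List.Properties using (∷-injectiveˡ; ∷-injectiveʳ)
open import Data.Nat using (zero; suc)
open import Data.Product using (Σ; _×_; _,_; proj₁; proj₂)
open import Data.Sum using (inj₁; inj₂)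
open import Data.Unit using (tt)
open import Function.Bundles using (_⇔_; mk⇔)
open import Level using (lift; lower)
open import Relation.Binary.PropositionalEquality using (_≡_; refl; cong; subst; module ≡-Reasoning)
open ≡-Reasoning

hatW-++ : ∀ {L} (u v : List (Lτ L)) → hatW (u ++ v) ≡ hatW u ++ hatW v
hatW-++ []            v = refl
hatW-++ (inj₁ a ∷ u)  v = cong (a ∷_) (hatW-++ u v)
hatW-++ (inj₂ _ ∷ u)  v = hatW-++ u v

hatW-replicateτ : ∀ {L} n → hatW {L} (replicateτ n) ≡ []
hatW-replicateτ zero    = refl
hatW-replicateτ (suc n) = hatW-replicateτ n

hatA-++-hatW : ∀ {L} (a : Lτ L) w → hatA a ++ hatW w ≡ hatW (a ∷ w)
hatA-++-hatW (inj₁ _) w = refl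
hatA-++-hatW (inj₂ _) w = refl

module _ {L S : Set} (F : LTS L S) where

  Steps-++ : ∀ (u v : List (Lτ L)) → (Steps F u · Steps F v) ≤A Steps F (u ++ v)
  Steps-++ []      v s s'' (.s , refl , q)       = q
  Steps-++ (a ∷ u) v s s'' (s' , (s₁ , p , q) , r) = s₁ , p , Steps-++ u v s₁ s'' (s' , q , r)

  WeakStep-++ : ∀ (u v : List L) → (WeakStep F u · WeakStep F v) ≤A WeakStep F (u ++ v)
  WeakStep-++ u v s s'' (s' , (w₁ , refl , p) , (w₂ , refl , q)) =
    w₁ ++ w₂ , hatW-++ w₁ w₂ , Steps-++ w₁ w₂ s s'' (s' , p , q)

  Steps⇒saturateτ : ∀ w {s s'} → hatW w ≡ [] → Steps F w s s' → saturate F τ s s'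
  Steps⇒saturateτ []             _  refl = 0 , refl
  Steps⇒saturateτ (inj₁ _ ∷ w)   () _
  Steps⇒saturateτ (inj₂ tt ∷ w)  eq (s₁ , p , q) with Steps⇒saturateτ w eq q
  ... | n , q' = suc n , s₁ , p , q'

  Steps⇒saturate : ∀ a w {s s'} → hatW w ≡ a ∷ [] → Steps F w s s' → saturate F (inj₁ a) s s'
  Steps⇒saturate a []            () _
  Steps⇒saturate a (inj₁ b ∷ w)  eq (s₁ , p , q) with ∷-injectiveˡ eq
  ... | refl with Steps⇒saturateτ w (∷-injectiveʳ eq) q
  ... | n , q' = 0 , n , s₁ , p , q'
  Steps⇒saturate a (inj₂ tt ∷ w) eq (s₁ , p , q) with Steps⇒saturate a w eq q
  ... | m , n , q' = suc m , n , s₁ , p , q'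

  WeakStep⇒saturate : ∀ a → WeakStep F (hatA a) ≤A saturate F a
  WeakStep⇒saturate (inj₁ a)  s s' (w , eq , p) = Steps⇒saturate a w eq p
  WeakStep⇒saturate (inj₂ tt) s s' (w , eq , p) = Steps⇒saturateτ w eq p

  saturate⇒WeakStep : ∀ a → saturate F a ≤A WeakStep F (hatA a)
  saturate⇒WeakStep (inj₂ tt) s s' (n , p) = replicateτ n , hatW-replicateτ n , p
  saturate⇒WeakStep (inj₁ a)  s s' (m , n , p) = w , hatW-w , p
    where
    w : List (Lτ L)
    w = replicateτ m ++ (inj₁ a ∷ replicateτ n)
    hatW-w : hatW w ≡ a ∷ []
    hatW-w = begin
      hatW w                                          ≡⟨ hatW-++ (replicateτ m) _ ⟩
      hatW (replicateτ m) ++ (a ∷ hatW (replicateτ n)) ≡⟨ cong (_++ _) (hatW-replicateτ m) ⟩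
      a ∷ hatW (replicateτ n)                          ≡⟨ cong (a ∷_) (hatW-replicateτ n) ⟩
      a ∷ []                                          ∎

  saturate-· : ∀ a b → (saturate F a · saturate F b) ≤A WeakStep F (hatA a ++ hatA b)
  saturate-· a b s s'' (s' , p , q) =
    WeakStep-++ (hatA a) (hatA b) s s''
      (s' , saturate⇒WeakStep a s s' p , saturate⇒WeakStep b s' s'' q)

  step⇒saturate : ∀ a → F a ≤A saturate F a
  step⇒saturate (inj₁ a)  s s' p = 0 , 0 , s' , p , refl
  step⇒saturate (inj₂ tt) s s' p = 1 , s' , p , refl

  saturate-isSaturated : IsSaturated (saturate F)
  saturate-isSaturated = refl′ , trans′ , sandwich
    where
    refl′ : idA ≤A saturate F τ
    refl′ s .s refl = 0 , refl

    trans′ : (saturate F τ · saturate F τ) ≤A saturate F τ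
    trans′ s s'' p = WeakStep⇒saturate τ s s'' (saturate-· τ τ s s'' p)

    sandwich : ∀ a → ((saturate F τ · saturate F (inj₁ a)) · saturate F τ) ≤A saturate F (inj₁ a)
    sandwich a s s'' (s' , p , q) =
      WeakStep⇒saturate (inj₁ a) s s''
        (WeakStep-++ (a ∷ []) [] s s''
          (s' , saturate-· τ (inj₁ a) s s' p , saturate⇒WeakStep τ s' s'' q))

IsWeakSimulation : {L S T : Set} → LTS L S → LTS L T → (S → T → Set) → Set
IsWeakSimulation {L} {S} {T} F G R = ∀ (a : Lτ L) (s : S) (t : T) → R s t →
  ∀ s' → F a s s' → Σ T λ t' → WeakStep G (hatA a) t t' × R s' t'

module _ {L S T : Set} {F : LTS L S} {G : LTS L T} {R : S → T → Set}
         (sim : IsWeakSimulation F G R) where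

  weakSim-Steps : ∀ w {s t s'} → R s t → Steps F w s s' →
                  Σ T λ t' → WeakStep G (hatW w) t t' × R s' t'
  weakSim-Steps [] {t = t} r refl = t , ([] , refl , refl) , r
  weakSim-Steps (a ∷ w) {s} {t} r (s₁ , p , q) with sim a s t r s₁ p
  ... | t₁ , step , r₁ with weakSim-Steps w r₁ q
  ... | t' , steps , r' =
    t' , subst (λ v → WeakStep G v t t') (hatA-++-hatW a w)
               (WeakStep-++ G (hatA a) (hatW w) t t' (t₁ , step , steps)) , r'

  weakSim-saturate : ∀ a s t → R s t → ∀ s' → saturate F a s s' →
                     Σ T λ t' → saturate G a t t' × R s' t'
  weakSim-saturate a s t r s' p with saturate⇒WeakStep F a s s' p
  ... | w , hatW-w , steps with weakSim-Steps w r steps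
  ... | t' , weak , r' =
    t' , WeakStep⇒saturate G a t t' (subst (λ v → WeakStep G v t t') hatW-w weak) , r'

module _ {L S T : Set} {F : LTS L S} {G : LTS L T} {R : S → T → Set} where

  weakBisim⇒saturate-𝒫Rel : IsWeakBisimulation F G R →
    ∀ a s t → R s t → 𝒫Rel R (saturate F a s) (saturate G a t)
  weakBisim⇒saturate-𝒫Rel wb a s t r =
    weakSim-saturate (λ a s t r → proj₁ (wb a s t r)) a s t r ,
    weakSim-saturate {R = λ t s → R s t} (λ a t s r → proj₂ (wb a s t r)) a t s r

  saturate-𝒫Rel⇒weakBisim : (∀ a s t → R s t → 𝒫Rel R (saturate F a s) (saturate G a t)) →
    IsWeakBisimulation F G R
  saturate-𝒫Rel⇒weakBisim h a s t r =
    (λ s' p → let t' , q , r' = proj₁ (h a s t r) s' (step⇒saturate F a s s' p)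
              in t' , saturate⇒WeakStep G a t t' q , r') ,
    (λ t' q → let s' , p , r' = proj₂ (h a s t r) t' (step⇒saturate G a t t' q)
              in s' , saturate⇒WeakStep F a s s' p , r')

mainTheorem3 : {L S T : Set} (F : LTS L S) (G : LTS L T) (R : S → T → Set) →
    (IsWeakBisimulation F G R ⇔ (∀ a s t → R s t → 𝒫Rel R (saturate F a s) (saturate G a t)))
    × (IsWeakBisimulation F G R ⇔
        ((∀ a → IsRelMorphism (objR R) (obj𝒫R R) (saturate F a) (saturate G a))
         × IsSaturated (saturate F) × IsSaturated (saturate G)))
mainTheorem3 F G R =
  mk⇔ weakBisim⇒saturate-𝒫Rel saturate-𝒫Rel⇒weakBisim ,
  mk⇔ (λ wb → (λ a s t r → lift (weakBisim⇒saturate-𝒫Rel wb a s t r))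
              , saturate-isSaturated F , saturate-isSaturated G)
      (λ (morphism , _) → saturate-𝒫Rel⇒weakBisim λ a s t r → lower (morphism a s t r))
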